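{- A double occurrence word $w$ contains a framing tangled cord (of some order $s\ge1$) if and only if $w$ cannot be written as a concatenation $uv$ of two double occurrence words $u$ and $v$ with no common letters.
   Context: A double occurrence word is a non-empty word in which each letter occurs exactly twice or not at all. For a set of letters $\sigma$, $w(\sigma)$ is the word obtained by concatenating all occurrences of letters of $\sigma$ in $w$ in the order they occur in $w$. A word $w$ of length $N$ contains a framing tangled cord of order $s$ if there exist letters $t_1,\dots,t_s$ with $w[1]=t_1$, $w[N]=t_s$, and $w(\{t_1,\dots,t_s\})=t_1t_2t_1t_3t_2\dots t_s\,t_{s-1}\,t_s$ (i.e. the tangled cord word $w_{TC_s}=1\,2\,1\,3\,2\dots s\,(s-1)\,s$ up to renaming; for $s=1$ this is $t_1t_1$). -}

module Defs where

open import Data.Nat using (ℕ; _≟_; _≥_)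
open import Data.List using (List; []; _∷_; _++_; length; filter; head; last)
open import Data.List.Membership.Propositional using (_∈_; _∉_)
open import Data.List.Membership.DecPropositional _≟_ using (_∈?_)
open import Data.List.Relation.Unary.Unique.Propositional using (Unique)
open import Data.Maybe using (Maybe; just)
open import Data.Product using (Σ; _×_; ∃; ∃-syntax)
open import Relation.Binary.PropositionalEquality using (_≡_; _≢_)

Word : Set
Word = List ℕ

occ : ℕ → Word → ℕ
occ a w = length (filter (_≟ a) w)

IsDOW : Word → Set
IsDOW w = (w ≢ []) × (∀ a → a ∈ w → occ a w ≡ 2)

restrict : Word → List ℕ → Word
restrict w σ = filter (_∈? σ) w

-- tangled cord word on letters t₁ … tₛ:  t₁ t₂ t₁ t₃ t₂ … tₛ tₛ₋₁ tₛ
-- (for s = 1 it is t₁ t₁)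
tcTail : ℕ → List ℕ → Word
tcTail prev []       = prev ∷ []
tcTail prev (t ∷ ts) = t ∷ prev ∷ tcTail t ts

tcWord : List ℕ → Word
tcWord []       = []
tcWord (t ∷ ts) = t ∷ tcTail t ts

FramingTCOfOrder : ℕ → Word → Set
FramingTCOfOrder s w =
  ∃[ ts ] (length ts ≡ s × Unique ts
          × head w ≡ head ts × last w ≡ last ts
          × restrict w ts ≡ tcWord ts)

HasFramingTC : Word → Set
HasFramingTC w = ∃[ s ] (s ≥ 1 × FramingTCOfOrder s w)

Decomposable : Word → Set
Decomposable w =
  ∃[ u ] ∃[ v ] (IsDOW u × IsDOW v × w ≡ u ++ v × (∀ a → a ∈ u → a ∉ v))

-- If w = u v is a decomposition, restricting it to the letters of a framing
-- tangled cord t₁ t₂ t₁ t₃ t₂ … tₛ tₛ₋₁ tₛ cuts the cord word into two non-empty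
-- parts (t₁ begins w, tₛ ends it); but consecutive letters of the cord word
-- interleave, so every such cut separates the two occurrences of some tᵢ.
-- Conversely, write an indecomposable w as a x₁ c x₂ a y₁ c y₂, where c is the
-- last letter after the second a that also occurs between the two a's (if there
-- is none, indecomposability forces w = a x a, framed by [a]). Deleting a and
-- the letters of x₁ x₂ leaves a shorter indecomposable word c F c y₂; its
-- framing cord c t₃ … tₛ, found by induction, extends to the framing cord
-- a c t₃ … tₛ of w.
module Submission where

open import Defs
open import Relation.Nullary using (¬_; Dec; yes; no; ¬?; contradiction)
open import Function.Bundles using (_⇔_; mk⇔)

open import Data.Empty using (⊥-elim)
open import Data.List using (List; []; _∷_; _++_; length; filter; head; last)
open import Data.List.Membership.Propositional using (_∈_; _∉_)
open import Data.List.Membership.Propositional.Properties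
  using (∈-++⁺ˡ; ∈-++⁺ʳ; ∈-++⁻; ∈-filter⁺; ∈-filter⁻; ∈-∃++)
open import Data.List.Properties
  using ( filter-++; filter-accept; filter-reject; filter-none; filter-all; filter-some
        ; filter-notAll; length-++; ++-assoc; ++-conicalʳ; ++-cancelʳ
        ; ∷-injectiveˡ; ∷-injectiveʳ)
open import Data.List.Relation.Binary.Subset.Propositional using (_⊆_)
open import Data.List.Relation.Unary.All as All using (All; []; _∷_)
open import Data.List.Relation.Unary.All.Properties using (¬Any⇒All¬)
open import Data.List.Relation.Unary.AllPairs using ([]; _∷_)
open import Data.List.Relation.Unary.Any as Any using (here; there)
open import Data.List.Relation.Unary.Unique.Propositional using (Unique)
open import Data.Maybe using (just)
open import Data.Maybe.Properties using (just-injective)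
open import Data.Nat using (ℕ; suc; _≟_; _+_; _<_; s≤s; z≤n)
open import Data.List.Membership.DecPropositional _≟_ using (_∈?_)
open import Data.Nat.Induction using (<-wellFounded)
open import Data.Nat.Properties
  using (+-suc; +-identityʳ; suc-injective; m+n≡0⇒m≡0; m+n≡0⇒n≡0; <⇒≢)
open import Data.Product using (_×_; _,_; proj₁; proj₂; ∃-syntax; ∃₂)
open import Data.Sum using (_⊎_; inj₁; inj₂)
open import Function using (_∘_)
open import Induction.WellFounded using (Acc; acc)
open import Level using (Level)
open import Relation.Binary.PropositionalEquality
  using (_≡_; _≢_; refl; sym; trans; cong; cong₂; subst; module ≡-Reasoning)
open import Relation.Unary as Unary using (Pred; Decidable; ∁)

open ≡-Reasoning

private
  variable
    ℓ ℓ′ : Level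
    A : Set ℓ

LetterDisjoint : List A → List A → Set _
LetterDisjoint u v = ∀ z → z ∈ u → z ∉ v

IsFramingTC : Word → List ℕ → Set
IsFramingTC w ts =
  Unique ts × head w ≡ head ts × last w ≡ last ts × restrict w ts ≡ tcWord ts

head≡just⇒∈ : ∀ {xs : List A} {y} → head xs ≡ just y → y ∈ xs
head≡just⇒∈ {xs = _ ∷ _} refl = here refl

last≡just⇒∈ : ∀ {xs : List A} {y} → last xs ≡ just y → y ∈ xs
last≡just⇒∈ {xs = _ ∷ []}    refl = here refl
last≡just⇒∈ {xs = _ ∷ _ ∷ _} eq   = there (last≡just⇒∈ eq)

last-∷ : ∀ (x : A) xs → ∃[ y ] last (x ∷ xs) ≡ just y
last-∷ x []       = x , refl
last-∷ x (y ∷ xs) = last-∷ y xs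

last-++-∷ : ∀ (xs : List A) y ys → last (xs ++ y ∷ ys) ≡ last (y ∷ ys)
last-++-∷ []           y ys = refl
last-++-∷ (_ ∷ [])     y ys = refl
last-++-∷ (_ ∷ x ∷ xs) y ys = last-++-∷ (x ∷ xs) y ys

suffix-after-∉ : ∀ (xs : List A) {y ys} u {v} →
                 xs ++ y ∷ ys ≡ u ++ v → y ∉ v → ∃[ m ] ys ≡ m ++ v
suffix-after-∉ xs       []      eq y∉v = ⊥-elim (y∉v (subst (_ ∈_) eq (∈-++⁺ʳ xs (here refl))))
suffix-after-∉ []       (_ ∷ u) eq _   = u , ∷-injectiveʳ eq
suffix-after-∉ (_ ∷ xs) (_ ∷ u) eq y∉v = suffix-after-∉ xs u (∷-injectiveʳ eq) y∉v

module _ {P : Pred A ℓ′} (P? : Decidable P) where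

  all∁⊎last : ∀ xs → All (∁ P) xs ⊎ ∃[ ys ] ∃[ z ] ∃[ zs ] (xs ≡ ys ++ z ∷ zs × P z × All (∁ P) zs)
  all∁⊎last [] = inj₁ []
  all∁⊎last (x ∷ xs) with all∁⊎last xs
  ... | inj₂ (ys , z , zs , refl , Pz , ¬Pzs) = inj₂ (x ∷ ys , z , zs , refl , Pz , ¬Pzs)
  ... | inj₁ ¬Pxs with P? x
  ...   | yes Px = inj₂ ([] , x , xs , refl , Px , ¬Pxs)
  ...   | no ¬Px = inj₁ (¬Px ∷ ¬Pxs)

  filter-only : ∀ {xs y ys} → All (∁ P) xs → P y → All (∁ P) ys → filter P? (xs ++ y ∷ ys) ≡ y ∷ []
  filter-only {xs} {y} {ys} ¬Pxs Py ¬Pys = begin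
    filter P? (xs ++ y ∷ ys)           ≡⟨ filter-++ P? xs (y ∷ ys) ⟩
    filter P? xs ++ filter P? (y ∷ ys) ≡⟨ cong₂ _++_ (filter-none P? ¬Pxs) (filter-accept P? Py) ⟩
    y ∷ filter P? ys                   ≡⟨ cong (y ∷_) (filter-none P? ¬Pys) ⟩
    y ∷ []                             ∎

  filter-filter-⊆ : ∀ {q} {Q : Pred A q} (Q? : Decidable Q) → P Unary.⊆ Q →
                    ∀ xs → filter P? (filter Q? xs) ≡ filter P? xs
  filter-filter-⊆ Q? P⊆Q []       = refl
  filter-filter-⊆ Q? P⊆Q (x ∷ xs) with Q? x
  ... | no ¬Qx = trans (filter-filter-⊆ Q? P⊆Q xs) (sym (filter-reject P? (¬Qx ∘ P⊆Q)))
  ... | yes _ with P? x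
  ...   | yes _ = cong (x ∷_) (filter-filter-⊆ Q? P⊆Q xs)
  ...   | no _  = filter-filter-⊆ Q? P⊆Q xs

  filter-cut-disjoint : ∀ {w u v} U → filter P? w ≡ u ++ v → w ≡ U ++ v →
                        LetterDisjoint u v → LetterDisjoint U v
  filter-cut-disjoint {w} {u} {v} U fw≡uv refl u#v z z∈U z∈v =
    u#v z (subst (z ∈_) fU≡u (∈-filter⁺ P? z∈U (All.lookup Pv z∈v))) z∈v
    where
    Pv : All P v
    Pv = All.tabulate λ y∈v →
      proj₂ (∈-filter⁻ P? {xs = w} (subst (_ ∈_) (sym fw≡uv) (∈-++⁺ʳ u y∈v)))
    fU≡u : filter P? U ≡ u
    fU≡u = ++-cancelʳ v (filter P? U) u (begin
      filter P? U ++ v            ≡⟨ cong (filter P? U ++_) (filter-all P? Pv) ⟨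
      filter P? U ++ filter P? v  ≡⟨ filter-++ P? U v ⟨
      filter P? (U ++ v)          ≡⟨ fw≡uv ⟩
      u ++ v                      ∎)

restrict-∷-∉ : ∀ {a} σ y → a ∉ y → restrict y (a ∷ σ) ≡ restrict y σ
restrict-∷-∉     σ []      _  = refl
restrict-∷-∉ {a} σ (z ∷ y) a∉ = by-cases (z ∈? σ)
  where
  ih : restrict y (a ∷ σ) ≡ restrict y σ
  ih = restrict-∷-∉ σ y (a∉ ∘ there)
  by-cases : Dec (z ∈ σ) → restrict (z ∷ y) (a ∷ σ) ≡ restrict (z ∷ y) σ
  by-cases (yes z∈σ) = begin
    restrict (z ∷ y) (a ∷ σ)  ≡⟨ filter-accept (_∈? a ∷ σ) (there z∈σ) ⟩
    z ∷ restrict y (a ∷ σ)    ≡⟨ cong (z ∷_) ih ⟩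
    z ∷ restrict y σ          ≡⟨ filter-accept (_∈? σ) z∈σ ⟨
    restrict (z ∷ y) σ        ∎
  by-cases (no z∉σ) = begin
    restrict (z ∷ y) (a ∷ σ)  ≡⟨ filter-reject (_∈? a ∷ σ) {z} {y} z∉a∷σ ⟩
    restrict y (a ∷ σ)        ≡⟨ ih ⟩
    restrict y σ              ≡⟨ filter-reject (_∈? σ) z∉σ ⟨
    restrict (z ∷ y) σ        ∎
    where
    z∉a∷σ : z ∉ a ∷ σ
    z∉a∷σ (here refl) = a∉ (here refl)
    z∉a∷σ (there z∈σ) = z∉σ z∈σ

occ-++ : ∀ z u v → occ z (u ++ v) ≡ occ z u + occ z v
occ-++ z u v = trans (cong length (filter-++ (_≟ z) u v)) (length-++ (filter (_≟ z) u))

occ-++-∷ : ∀ z u v → occ z (u ++ z ∷ v) ≡ suc (occ z u + occ z v)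
occ-++-∷ z u v = begin
  occ z (u ++ z ∷ v)       ≡⟨ occ-++ z u (z ∷ v) ⟩
  occ z u + occ z (z ∷ v)  ≡⟨ cong (occ z u +_) (cong length (filter-accept (_≟ z) refl)) ⟩
  occ z u + suc (occ z v)  ≡⟨ +-suc (occ z u) (occ z v) ⟩
  suc (occ z u + occ z v)  ∎

∉⇒occ≡0 : ∀ {z w} → z ∉ w → occ z w ≡ 0
∉⇒occ≡0 z∉w = cong length (filter-none (_≟ _) (¬Any⇒All¬ _ (z∉w ∘ Any.map sym)))

occ≡0⇒∉ : ∀ {z w} → occ z w ≡ 0 → z ∉ w
occ≡0⇒∉ occ≡0 z∈w = <⇒≢ (filter-some (_≟ _) (Any.map sym z∈w)) (sym occ≡0)

occ-twice⇒∉ : ∀ z p q r → occ z (p ++ z ∷ q ++ z ∷ r) ≡ 2 → z ∉ p × z ∉ q × z ∉ r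
occ-twice⇒∉ z p q r twice =
  occ≡0⇒∉ (m+n≡0⇒m≡0 _ sum≡0) , occ≡0⇒∉ (m+n≡0⇒m≡0 _ q+r≡0) , occ≡0⇒∉ (m+n≡0⇒n≡0 _ q+r≡0)
  where
  sum≡0 : occ z p + (occ z q + occ z r) ≡ 0
  sum≡0 = suc-injective (suc-injective (begin
    suc (suc (occ z p + (occ z q + occ z r)))  ≡⟨ cong suc (+-suc (occ z p) _) ⟨
    suc (occ z p + suc (occ z q + occ z r))    ≡⟨ cong (suc ∘ (occ z p +_)) (occ-++-∷ z q r) ⟨
    suc (occ z p + occ z (q ++ z ∷ r))         ≡⟨ occ-++-∷ z p (q ++ z ∷ r) ⟨
    occ z (p ++ z ∷ q ++ z ∷ r)                ≡⟨ twice ⟩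
    2                                          ∎))
  q+r≡0 : occ z q + occ z r ≡ 0
  q+r≡0 = m+n≡0⇒n≡0 (occ z p) sum≡0

second-occurrence : ∀ {a r} → IsDOW (a ∷ r) → ∃₂ λ x y → r ≡ x ++ a ∷ y × a ∉ x × a ∉ y
second-occurrence {a} {r} (_ , twice) with a ∈? r
... | no a∉r = contradiction (trans (sym (cong suc (∉⇒occ≡0 a∉r))) occ≡1) λ ()
  where
  occ≡1 : suc (occ a r) ≡ 2
  occ≡1 = trans (sym (cong length (filter-accept (_≟ a) refl))) (twice a (here refl))
... | yes a∈r with x , y , refl ← ∈-∃++ a∈r =
  let _ , a∉x , a∉y = occ-twice⇒∉ a [] x y (twice a (here refl)) in x , y , refl , a∉x , a∉y

disjoint-split⇒Decomposable : ∀ {w u v} → IsDOW w → w ≡ u ++ v → u ≢ [] → v ≢ [] →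
                              LetterDisjoint u v → Decomposable w
disjoint-split⇒Decomposable {u = u} {v} (_ , twice) refl u≢[] v≢[] u#v =
  u , v , (u≢[] , twiceᵘ) , (v≢[] , twiceᵛ) , refl , u#v
  where
  twiceᵘ : ∀ z → z ∈ u → occ z u ≡ 2
  twiceᵘ z z∈u = begin
    occ z u            ≡⟨ +-identityʳ (occ z u) ⟨
    occ z u + 0        ≡⟨ cong (occ z u +_) (∉⇒occ≡0 (u#v z z∈u)) ⟨
    occ z u + occ z v  ≡⟨ occ-++ z u v ⟨
    occ z (u ++ v)     ≡⟨ twice z (∈-++⁺ˡ z∈u) ⟩
    2                  ∎
  twiceᵛ : ∀ z → z ∈ v → occ z v ≡ 2
  twiceᵛ z z∈v = begin
    occ z v            ≡⟨ cong (_+ occ z v) (∉⇒occ≡0 (λ z∈u → u#v z z∈u z∈v)) ⟨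
    occ z u + occ z v  ≡⟨ occ-++ z u v ⟨
    occ z (u ++ v)     ≡⟨ twice z (∈-++⁺ʳ u z∈v) ⟩
    2                  ∎

IsDOW-filter : ∀ {P : Pred ℕ ℓ′} (P? : Decidable P) {w} →
               IsDOW w → filter P? w ≢ [] → IsDOW (filter P? w)
IsDOW-filter P? {w} (_ , twice) ne = ne , λ z z∈ →
  let z∈w , Pz = ∈-filter⁻ P? z∈ in
  trans (cong length (filter-filter-⊆ (_≟ z) P? (λ { refl → Pz }) w)) (twice z z∈w)

tcTail-⊇ : ∀ prev ts → prev ∷ ts ⊆ tcTail prev ts
tcTail-⊇ prev []       z∈                   = z∈
tcTail-⊇ prev (t ∷ ts) (here refl)          = there (here refl)
tcTail-⊇ prev (t ∷ ts) (there (here e))     = here e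
tcTail-⊇ prev (t ∷ ts) (there (there z∈ts)) = there (there (tcTail-⊇ t ts (there z∈ts)))

tcWord-⊇ : ∀ ts → ts ⊆ tcWord ts
tcWord-⊇ (t ∷ ts) (here e)   = here e
tcWord-⊇ (t ∷ ts) (there z∈) = there (tcTail-⊇ t ts (there z∈))

tcTail-indecomposable : ∀ prev ts p q → tcTail prev ts ≡ p ++ q → q ≢ [] →
                        ¬ LetterDisjoint (prev ∷ p) q
tcTail-indecomposable prev []       []       q eq _    p#q =
  p#q prev (here refl) (subst (prev ∈_) eq (here refl))
tcTail-indecomposable prev []       (_ ∷ p)  q eq q≢[] _   =
  q≢[] (++-conicalʳ p q (sym (∷-injectiveʳ eq)))
tcTail-indecomposable prev (t ∷ ts) []       q eq _    p#q =
  p#q prev (here refl) (subst (prev ∈_) eq (there (here refl)))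
tcTail-indecomposable prev (t ∷ ts) (_ ∷ []) q eq _    p#q =
  p#q prev (here refl) (subst (prev ∈_) (∷-injectiveʳ eq) (here refl))
tcTail-indecomposable prev (t ∷ ts) (_ ∷ _ ∷ p) q eq q≢[] p#q with refl ← ∷-injectiveˡ eq =
  tcTail-indecomposable t ts p q (∷-injectiveʳ (∷-injectiveʳ eq)) q≢[] λ where
    z (here refl)  → p#q z (there (here refl))
    z (there z∈p) → p#q z (there (there (there z∈p)))

tcWord-indecomposable : ∀ ts p q → tcWord ts ≡ p ++ q → p ≢ [] → q ≢ [] → ¬ LetterDisjoint p q
tcWord-indecomposable ts       []      q _  p≢[] _    = contradiction refl p≢[]
tcWord-indecomposable (t ∷ ts) (_ ∷ p) q eq _    q≢[] with refl ← ∷-injectiveˡ eq =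
  tcTail-indecomposable t ts p q (∷-injectiveʳ eq) q≢[]

restrict-≢[] : ∀ {z u ts} → z ∈ u → z ∈ ts → restrict u ts ≢ []
restrict-≢[] z∈u z∈ts eq with () ← subst (_ ∈_) eq (∈-filter⁺ (_∈? _) z∈u z∈ts)

framingTC⇒irreducible : ∀ {w} → HasFramingTC w → ¬ Decomposable w
framingTC⇒irreducible _ ([] , _ , (u≢[] , _) , _) = u≢[] refl
framingTC⇒irreducible _ (_ , [] , _ , (v≢[] , _) , _) = v≢[] refl
framingTC⇒irreducible (_ , _ , ts , _ , _ , hd , lst , rs) (h ∷ u , z ∷ v , _ , _ , refl , u#v) =
  tcWord-indecomposable ts p q (trans (sym rs) (filter-++ (_∈? ts) (h ∷ u) (z ∷ v))) p≢[] q≢[] p#q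
  where
  p q : Word
  p = restrict (h ∷ u) ts
  q = restrict (z ∷ v) ts
  p≢[] : p ≢ []
  p≢[] = restrict-≢[] {u = h ∷ u} {ts} (here refl) (head≡just⇒∈ (sym hd))
  q≢[] : q ≢ []
  q≢[] with y , last≡y ← last-∷ z v =
    restrict-≢[] {u = z ∷ v} {ts} (last≡just⇒∈ last≡y) (last≡just⇒∈ (begin
      last ts                 ≡⟨ lst ⟨
      last (h ∷ u ++ z ∷ v)   ≡⟨ last-++-∷ (h ∷ u) z v ⟩
      last (z ∷ v)            ≡⟨ last≡y ⟩
      just y                  ∎))
  p#q : LetterDisjoint p q
  p#q y y∈p y∈q = u#v y (proj₁ (∈-filter⁻ (_∈? ts) y∈p)) (proj₁ (∈-filter⁻ (_∈? ts) y∈q))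

order-one-frame : ∀ {a x y} → IsDOW (a ∷ x ++ a ∷ y) → ¬ Decomposable (a ∷ x ++ a ∷ y) →
                 a ∉ x → a ∉ y → All (_∉ x) y → IsFramingTC (a ∷ x ++ a ∷ y) (a ∷ [])
order-one-frame {a} {x} {[]} _ _ a∉x _ _ =
  [] ∷ [] , refl , last-++-∷ (a ∷ x) a [] ,
  trans (filter-accept (_∈? a ∷ []) (here refl))
        (cong (a ∷_) (filter-only (_∈? a ∷ []) (All.tabulate x∌a) (here refl) []))
  where
  x∌a : ∀ {z} → z ∈ x → z ∉ a ∷ []
  x∌a z∈x (here refl) = a∉x z∈x
order-one-frame {a} {x} {z ∷ y} dow irr _ a∉y y#x =
  contradiction (disjoint-split⇒Decomposable dow axa++y (λ ()) (λ ()) axa#y) irr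
  where
  axa++y : a ∷ x ++ a ∷ z ∷ y ≡ (a ∷ x ++ a ∷ []) ++ z ∷ y
  axa++y = cong (a ∷_) (sym (++-assoc x (a ∷ []) (z ∷ y)))
  axa#y : LetterDisjoint (a ∷ x ++ a ∷ []) (z ∷ y)
  axa#y b (here refl) = a∉y
  axa#y b (there b∈) with ∈-++⁻ x b∈
  ... | inj₁ b∈x        = λ b∈y → All.lookup y#x b∈y b∈x
  ... | inj₂ (here refl) = a∉y

module Reduction {a c : ℕ} {x₁ x₂ y₁ y₂ : Word}
  (dow : IsDOW (a ∷ (x₁ ++ c ∷ x₂) ++ a ∷ y₁ ++ c ∷ y₂))
  (a∉x : a ∉ x₁ ++ c ∷ x₂) (a∉y : a ∉ y₁ ++ c ∷ y₂) (y₂#x : All (_∉ x₁ ++ c ∷ x₂) y₂)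
  where

  x y w : Word
  x = x₁ ++ c ∷ x₂
  y = y₁ ++ c ∷ y₂
  w = a ∷ x ++ a ∷ y

  dropped : Word
  dropped = a ∷ x₁ ++ x₂

  Kept : Pred ℕ _
  Kept z = z ∉ dropped

  kept? : Decidable Kept
  kept? z = ¬? (z ∈? dropped)

  w′ : Word
  w′ = filter kept? w

  c-once : c ∉ a ∷ x₁ × c ∉ x₂ ++ a ∷ y₁ × c ∉ y₂
  c-once = occ-twice⇒∉ c (a ∷ x₁) (x₂ ++ a ∷ y₁) y₂
    (trans (cong (occ c) regroup) (proj₂ dow c (there (∈-++⁺ˡ (∈-++⁺ʳ x₁ (here refl))))))
    where
    regroup : a ∷ x₁ ++ c ∷ (x₂ ++ a ∷ y₁) ++ c ∷ y₂ ≡ w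
    regroup = cong (a ∷_) (begin
      x₁ ++ c ∷ (x₂ ++ a ∷ y₁) ++ c ∷ y₂  ≡⟨ cong (λ t → x₁ ++ c ∷ t) (++-assoc x₂ (a ∷ y₁) (c ∷ y₂)) ⟩
      x₁ ++ c ∷ x₂ ++ a ∷ y               ≡⟨ ++-assoc x₁ (c ∷ x₂) (a ∷ y) ⟨
      x ++ a ∷ y                          ∎)

  x₁x₂⊆x : x₁ ++ x₂ ⊆ x
  x₁x₂⊆x z∈ with ∈-++⁻ x₁ z∈
  ... | inj₁ z∈x₁ = ∈-++⁺ˡ z∈x₁
  ... | inj₂ z∈x₂ = ∈-++⁺ʳ x₁ (there z∈x₂)

  c-kept : Kept c
  c-kept (here c≡a)  = a∉x (subst (_∈ x) c≡a (∈-++⁺ʳ x₁ (here refl)))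
  c-kept (there c∈) with ∈-++⁻ x₁ c∈
  ... | inj₁ c∈x₁ = proj₁ c-once (there c∈x₁)
  ... | inj₂ c∈x₂ = proj₁ (proj₂ c-once) (∈-++⁺ˡ c∈x₂)

  y₂-kept : All Kept y₂
  y₂-kept = All.tabulate λ where
    z∈y₂ (here refl) → a∉y (∈-++⁺ʳ y₁ (there z∈y₂))
    z∈y₂ (there z∈) → All.lookup y₂#x z∈y₂ (x₁x₂⊆x z∈)

  a-dropped : ¬ Kept a
  a-dropped a-kept = a-kept (here refl)

  w′≡ : w′ ≡ c ∷ filter kept? y
  w′≡ = begin
    filter kept? w                               ≡⟨ filter-reject kept? a-dropped ⟩
    filter kept? (x ++ a ∷ y)                    ≡⟨ filter-++ kept? x (a ∷ y) ⟩
    filter kept? x ++ filter kept? (a ∷ y)       ≡⟨ cong₂ _++_ filter-x (filter-reject kept? a-dropped) ⟩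
    c ∷ filter kept? y                           ∎
    where
    filter-x : filter kept? x ≡ c ∷ []
    filter-x = filter-only kept? {x₁} {c} {x₂}
      (All.tabulate λ z∈x₁ z-kept → z-kept (there (∈-++⁺ˡ z∈x₁))) c-kept
      (All.tabulate λ z∈x₂ z-kept → z-kept (there (∈-++⁺ʳ x₁ z∈x₂)))

  w′≡cFcy₂ : w′ ≡ (c ∷ filter kept? y₁) ++ c ∷ y₂
  w′≡cFcy₂ = begin
    w′
      ≡⟨ w′≡ ⟩
    c ∷ filter kept? y
      ≡⟨ cong (c ∷_) (filter-++ kept? y₁ (c ∷ y₂)) ⟩
    c ∷ filter kept? y₁ ++ filter kept? (c ∷ y₂)
      ≡⟨ cong (λ t → c ∷ filter kept? y₁ ++ t) (filter-accept kept? c-kept) ⟩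
    c ∷ filter kept? y₁ ++ c ∷ filter kept? y₂
      ≡⟨ cong (λ t → c ∷ filter kept? y₁ ++ c ∷ t) (filter-all kept? y₂-kept) ⟩
    c ∷ filter kept? y₁ ++ c ∷ y₂
      ∎

  w′-shorter : length w′ < length w
  w′-shorter = filter-notAll kept? w (here a-dropped)

  w′-DOW : IsDOW w′
  w′-DOW = IsDOW-filter kept? dow λ w′≡[] → contradiction (trans (sym w′≡) w′≡[]) λ ()

  w′-irreducible : ¬ Decomposable w → ¬ Decomposable w′
  w′-irreducible irr ([] , _ , (u′≢[] , _) , _) = u′≢[] refl
  w′-irreducible irr (h ∷ u′ , v′ , _ , (v′≢[] , _) , w′≡hu′v′ , u′#v′) =
    irr (disjoint-split⇒Decomposable dow w≡Uv′ (λ ()) v′≢[]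
          (filter-cut-disjoint kept? U w′≡hu′v′ w≡Uv′ u′#v′))
    where
    c∉v′ : c ∉ v′
    c∉v′ = u′#v′ c (here (∷-injectiveˡ (trans (sym w′≡) w′≡hu′v′)))
    y₂-split : ∃[ m ] y₂ ≡ m ++ v′
    y₂-split = suffix-after-∉ (c ∷ filter kept? y₁) (h ∷ u′) (trans (sym w′≡cFcy₂) w′≡hu′v′) c∉v′
    m U : Word
    m = proj₁ y₂-split
    U = a ∷ x ++ a ∷ y₁ ++ c ∷ m
    w≡Uv′ : w ≡ U ++ v′
    w≡Uv′ = begin
      a ∷ x ++ a ∷ y₁ ++ c ∷ y₂         ≡⟨ cong (λ t → a ∷ x ++ a ∷ y₁ ++ c ∷ t) (proj₂ y₂-split) ⟩
      a ∷ x ++ a ∷ y₁ ++ c ∷ m ++ v′    ≡⟨ cong (λ t → a ∷ x ++ a ∷ t) (++-assoc y₁ (c ∷ m) v′) ⟨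
      a ∷ x ++ (a ∷ y₁ ++ c ∷ m) ++ v′  ≡⟨ cong (a ∷_) (++-assoc x (a ∷ y₁ ++ c ∷ m) v′) ⟨
      U ++ v′                           ∎

  lift : ∀ {t ts} → IsFramingTC w′ (t ∷ ts) → IsFramingTC w (a ∷ t ∷ ts)
  lift {t} {ts} (uq , hd , lst , rs) with refl ← just-injective (trans (cong head (sym w′≡)) hd) =
    ¬Any⇒All¬ σ a∉σ ∷ uq , refl , last≡ , restrict≡
    where
    σ : List ℕ
    σ = c ∷ ts

    σ-kept : ∀ {z} → z ∈ σ → Kept z
    σ-kept {z} z∈σ = proj₂ (∈-filter⁻ kept? {xs = w} z∈w′)
      where
      z∈w′ : z ∈ w′
      z∈w′ = proj₁ (∈-filter⁻ (_∈? σ) {xs = w′} (subst (_ ∈_) (sym rs) (tcWord-⊇ σ z∈σ)))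

    a∉σ : a ∉ σ
    a∉σ = a-dropped ∘ σ-kept

    last≡ : last w ≡ last σ
    last≡ = begin
      last w                                ≡⟨ last-++-∷ (a ∷ x) a y ⟩
      last (a ∷ y₁ ++ c ∷ y₂)               ≡⟨ last-++-∷ (a ∷ y₁) c y₂ ⟩
      last (c ∷ y₂)                         ≡⟨ last-++-∷ (c ∷ filter kept? y₁) c y₂ ⟨
      last (c ∷ filter kept? y₁ ++ c ∷ y₂)  ≡⟨ cong last w′≡cFcy₂ ⟨
      last w′                               ≡⟨ lst ⟩
      last σ                                ∎

    restrict-y : restrict y σ ≡ tcTail c ts
    restrict-y = ∷-injectiveʳ (begin
      c ∷ restrict y σ                     ≡⟨ cong (c ∷_) (filter-filter-⊆ (_∈? σ) kept? σ-kept y) ⟨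
      c ∷ filter (_∈? σ) (filter kept? y)  ≡⟨ filter-accept (_∈? σ) (here refl) ⟨
      restrict (c ∷ filter kept? y) σ      ≡⟨ cong (λ l → restrict l σ) w′≡ ⟨
      restrict w′ σ                        ≡⟨ rs ⟩
      tcWord σ                             ∎)

    restrict-x : restrict x (a ∷ σ) ≡ c ∷ []
    restrict-x = filter-only (_∈? a ∷ σ) {x₁} {c} {x₂}
      (All.tabulate (dropped∉ ∘ ∈-++⁺ˡ)) (there (here refl))
      (All.tabulate (dropped∉ ∘ ∈-++⁺ʳ x₁))
      where
      dropped∉ : ∀ {z} → z ∈ x₁ ++ x₂ → z ∉ a ∷ σ
      dropped∉ z∈ (here refl) = a∉x (x₁x₂⊆x z∈)
      dropped∉ z∈ (there z∈σ) = σ-kept z∈σ (there z∈)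

    restrict≡ : restrict w (a ∷ σ) ≡ tcWord (a ∷ σ)
    restrict≡ = begin
      restrict w (a ∷ σ)
        ≡⟨ filter-accept (_∈? a ∷ σ) (here refl) ⟩
      a ∷ restrict (x ++ a ∷ y) (a ∷ σ)
        ≡⟨ cong (a ∷_) (filter-++ (_∈? a ∷ σ) x (a ∷ y)) ⟩
      a ∷ restrict x (a ∷ σ) ++ restrict (a ∷ y) (a ∷ σ)
        ≡⟨ cong₂ (λ l r → a ∷ l ++ r) restrict-x (filter-accept (_∈? a ∷ σ) (here refl)) ⟩
      a ∷ c ∷ a ∷ restrict y (a ∷ σ)
        ≡⟨ cong (λ l → a ∷ c ∷ a ∷ l) (trans (restrict-∷-∉ σ y a∉y) restrict-y) ⟩
      a ∷ c ∷ a ∷ tcTail c ts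
        ∎

irreducible⇒framingTC : ∀ {w} → Acc _<_ (length w) → IsDOW w → ¬ Decomposable w →
                        ∃₂ λ t ts → IsFramingTC w (t ∷ ts)
irreducible⇒framingTC {[]} _ (w≢[] , _) _ = contradiction refl w≢[]
irreducible⇒framingTC {a ∷ _} (acc rec) dow irr
  with x , y , refl , a∉x , a∉y ← second-occurrence dow
  with all∁⊎last (_∈? x) y
... | inj₁ y#x = a , [] , order-one-frame dow irr a∉x a∉y y#x
... | inj₂ (y₁ , c , y₂ , refl , c∈x , y₂#x) with x₁ , x₂ , refl ← ∈-∃++ c∈x =
  let open Reduction dow a∉x a∉y y₂#x using (w′-shorter; w′-DOW; w′-irreducible; lift)
      t , ts , frame = irreducible⇒framingTC (rec w′-shorter) w′-DOW (w′-irreducible irr)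
  in a , t ∷ ts , lift frame

corollary4p4 : (w : Word) → IsDOW w → (HasFramingTC w ⇔ (¬ Decomposable w))
corollary4p4 w dow = mk⇔ framingTC⇒irreducible λ irr →
  let t , ts , frame = irreducible⇒framingTC (<-wellFounded (length w)) dow irr
  in length (t ∷ ts) , s≤s z≤n , t ∷ ts , refl , frame
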